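{- For any connected graphs $G_1$ and $G_2$, $$pd(G_1\times G_2)\le dim(G_1)+dim(G_2)+1.$$
   Context: All graphs are finite, simple and connected; $d(u,v)$ is the shortest-path distance, and $d(v,P)=\min\{d(v,x):x\in P\}$ for a nonempty vertex set $P$. For an ordered set $S=\{v_1,\dots,v_k\}$ of vertices, $r(v|S)=(d(v,v_1),\dots,d(v,v_k))$; $S$ is a resolving set if $r(u|S)\neq r(v|S)$ for all distinct vertices $u,v$, and the metric dimension $dim(G)$ is the minimum cardinality of a resolving set. For an ordered partition $\Pi=\{P_1,\dots,P_t\}$ of the vertex set, $r(v|\Pi)=(d(v,P_1),\dots,d(v,P_t))$; $\Pi$ is a resolving partition if all these vectors are distinct, and the partition dimension $pd(G)$ is the minimum number of sets in a resolving partition. The Cartesian product $G_1\times G_2$ has vertex set $V_1\times V_2$, with $(a,b)\sim(c,d)$ iff ($a=c$ and $bd\in E_2$) or ($b=d$ and $ac\in E_1$). -}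

module Defs where

open import Data.Nat using (ℕ; zero; suc; _+_; _≤_)
open import Data.Fin using (Fin)
open import Data.Product using (Σ; ∃; ∃-syntax; _×_; _,_; proj₁; proj₂)
open import Data.Sum using (_⊎_; inj₁; inj₂)
open import Data.List using (List; cartesianProduct)
open import Data.List.Membership.Propositional using (_∈_)
open import Data.List.Membership.Propositional.Properties using (∈-cartesianProduct⁺)
open import Relation.Nullary using (¬_)
open import Relation.Binary.PropositionalEquality using (_≡_; refl; sym)
open import Function.Definitions using (Injective; Surjective)

record Graph : Set₁ where
  field
    V        : Set
    vertices : List V
    complete : ∀ v → v ∈ vertices        -- V is finite
    Adj      : V → V → Set
    irrefl   : ∀ v → ¬ Adj v v
    sym-adj  : ∀ {u v} → Adj u v → Adj v u

open Graph public

data Walk (G : Graph) : V G → V G → Set where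
  [] : ∀ {v} → Walk G v v
  _∷_ : ∀ {u w v} → Adj G u w → Walk G w v → Walk G u v

length : ∀ {G u v} → Walk G u v → ℕ
length [] = zero
length (_ ∷ p) = suc (length p)

Connected : Graph → Set
Connected G = ∀ (u v : V G) → Walk G u v

IsDist : (G : Graph) → V G → V G → ℕ → Set
IsDist G u v k = (Σ (Walk G u v) λ p → length p ≡ k)
               × (∀ (p : Walk G u v) → k ≤ length p)

IsResolvingSet : (G : Graph) → {k : ℕ} → (Fin k → V G) → Set
IsResolvingSet G {k} S =
  Injective _≡_ _≡_ S ×
  (∀ (u v : V G) → ¬ u ≡ v →
     Σ (Fin k) λ i → ∀ a b → IsDist G u (S i) a → IsDist G v (S i) b → ¬ a ≡ b)

IsMetricDim : Graph → ℕ → Set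
IsMetricDim G k =
  (Σ (Fin k → V G) λ S → IsResolvingSet G S) ×
  (∀ {m} (S : Fin m → V G) → IsResolvingSet G S → k ≤ m)

IsDistToSet : (G : Graph) → V G → (V G → Set) → ℕ → Set
IsDistToSet G v P k =
  (Σ (V G) λ x → P x × IsDist G v x k) ×
  (∀ x → P x → ∀ m → IsDist G v x m → k ≤ m)

-- an ordered partition Π = {P₁,…,P_t} given by the class map
-- c : V → Fin t (P_i = c⁻¹(i)); every class is nonempty
IsResolvingPartition : (G : Graph) → {t : ℕ} → (V G → Fin t) → Set
IsResolvingPartition G {t} c =
  Surjective _≡_ _≡_ c ×
  (∀ (u v : V G) → ¬ u ≡ v →
     Σ (Fin t) λ i → ∀ a b →
       IsDistToSet G u (λ x → c x ≡ i) a →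
       IsDistToSet G v (λ x → c x ≡ i) b → ¬ a ≡ b)

IsPartitionDim : Graph → ℕ → Set
IsPartitionDim G t =
  (Σ (V G → Fin t) λ c → IsResolvingPartition G c) ×
  (∀ {m} (c : V G → Fin m) → IsResolvingPartition G c → t ≤ m)

_□_ : Graph → Graph → Graph
G □ H = record
  { V        = V G × V H
  ; vertices = cartesianProduct (vertices G) (vertices H)
  ; complete = λ { (a , b) → ∈-cartesianProduct⁺ (complete G a) (complete H b) }
  ; Adj      = λ { (a , b) (c , d) → (a ≡ c × Adj H b d) ⊎ (b ≡ d × Adj G a c) }
  ; irrefl   = λ { (a , b) (inj₁ (_ , e)) → irrefl H b e
                 ; (a , b) (inj₂ (_ , e)) → irrefl G a e }
  ; sym-adj  = λ { (inj₁ (refl , e)) → inj₁ (refl , sym-adj H e)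
                 ; (inj₂ (refl , e)) → inj₂ (refl , sym-adj G e) }
  }

-- Let S₁, S₂ be metric bases. Being minimum, each misses some vertex (a resolving set
-- containing every vertex stays resolving after dropping one). Partition G₁ □ G₂ into the
-- rows V₁ × {S₂ j}, the column pieces {S₁ i} × (V₂ ∖ S₂) and one class for the rest. The
-- distance from (a , b) to the row of S₂ j is d(b, S₂ j), so a row separates vertices with
-- different second coordinates. For a class inside the column over s, the distance from
-- (a , b) minus d(a, s) depends only on b, so a column piece separates vertices of one row.
-- Distances and equality of vertices are only available under double negation, which is
-- harmless because the conclusion is a decidable inequality.

module Submission where

open import Defs
open import Data.Empty using (⊥-elim)
open import Data.Fin using (Fin; zero; suc)
import Data.Fin.Properties as Fin
open import Data.List using ([]; _∷_)
open import Data.List.Relation.Unary.Any.Properties using (¬Any[])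
import Data.List.Relation.Unary.All as All
open import Data.Nat using (ℕ; zero; suc; _+_; _≤_; _<_; _≤?_; z≤n)
open import Data.Nat.Induction using (<-rec)
open import Data.Nat.Properties
open import Data.Product using (Σ; ∃; _×_; _,_; proj₁; proj₂)
open import Data.Sum using (_⊎_; inj₁; inj₂)
open import Data.Sum.Function.Propositional using (_⊎-↔_)
open import Effect.Monad using (RawMonad)
open import Function using (_∘_; _↔_; Inverse)
open import Function.Definitions using (Surjective)
open import Function.Properties.Inverse using (↔-refl; ↔-trans)
open import Level using (0ℓ)
open import Relation.Binary.Definitions using (DecidableEquality)
open import Relation.Binary.PropositionalEquality
open import Relation.Nullary using (¬_; Dec; yes; no; contradiction)
open import Relation.Nullary.Decidable using (decidable-stable; ¬¬-excluded-middle)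
open import Relation.Nullary.Negation using (DoubleNegation; ¬¬-Monad)

open RawMonad (¬¬-Monad {0ℓ})

≤-stable : ∀ {m n} → DoubleNegation (m ≤ n) → m ≤ n
≤-stable = decidable-stable (_ ≤? _)

¬¬-least : (P : ℕ → Set) {n : ℕ} → P n →
           DoubleNegation (∃ λ m → P m × (∀ k → P k → m ≤ k))
¬¬-least P {n} = <-rec (λ n → P n → DoubleNegation Least) step n
  where
  Least = ∃ λ m → P m × (∀ k → P k → m ≤ k)
  step : ∀ n → (∀ {m} → m < n → P m → DoubleNegation Least) → P n → DoubleNegation Least
  step n below pn = do
    yes (m , m<n , pm) ← ¬¬-excluded-middle {A = ∃ λ m → m < n × P m}
      where no ∄smaller → pure (n , pn , λ k pk → ≮⇒≥ (λ k<n → ∄smaller (k , k<n , pk)))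
    below m<n pm

module _ (G : Graph) where

  vertex-or-empty : V G ⊎ ¬ V G
  vertex-or-empty with vertices G | complete G
  ... | []    | complete′ = inj₂ (¬Any[] ∘ complete′)
  ... | v ∷ _ | _         = inj₁ v

  ¬¬-∀-vertex : {Q : V G → Set} → (∀ v → DoubleNegation (Q v)) → DoubleNegation (∀ v → Q v)
  ¬¬-∀-vertex ¬¬q = do
    qs ← All.sequenceM 0ℓ ¬¬-Monad (All.tabulate (λ {v} _ → ¬¬q v))
    pure (λ v → All.lookup qs (complete G v))

  ¬¬-decEq : DoubleNegation (DecidableEquality (V G))
  ¬¬-decEq = ¬¬-∀-vertex λ u → ¬¬-∀-vertex λ v → ¬¬-excluded-middle

  ¬¬-dist : ∀ {u v} → Walk G u v → DoubleNegation (∃ (IsDist G u v))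
  ¬¬-dist {u} {v} w = do
    (m , (p , refl) , least) ← ¬¬-least (λ m → Σ (Walk G u v) λ p → length p ≡ m) (w , refl)
    pure (m , (p , refl) , λ q → least (length q) (q , refl))

  distToSet-≤-walk : ∀ {v P k x} → IsDistToSet G v P k → P x → (w : Walk G v x) → k ≤ length w
  distToSet-≤-walk (_ , least) px w = ≤-stable do
    (m , dm) ← ¬¬-dist w
    pure (≤-trans (least _ px m dm) (proj₂ dm w))

  dist-self : ∀ {u a} → IsDist G u u a → a ≡ 0
  dist-self (_ , least) = n≤0⇒n≡0 (least [])

  dist-zero : ∀ {u v} → IsDist G u v 0 → u ≡ v
  dist-zero (([] , _) , _) = refl

  self-separates : ∀ {u v a b} → ¬ u ≡ v → IsDist G u u a → IsDist G v u b → ¬ a ≡ b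
  self-separates u≢v da db refl rewrite dist-self da = u≢v (sym (dist-zero db))

module _ (G : Graph) (_≟_ : DecidableEquality (V G)) where

  resolving-tail : ∀ {k} (S : Fin (suc k) → V G) → IsResolvingSet G S →
                   (∀ v → ∃ λ i → v ≡ S i) → IsResolvingSet G (S ∘ suc)
  resolving-tail S (S-inj , resolves) covers = Fin.suc-injective ∘ S-inj , separate
    where
    separate : ∀ u v → ¬ u ≡ v → ∃ λ i → ∀ a b →
               IsDist G u (S (suc i)) a → IsDist G v (S (suc i)) b → ¬ a ≡ b
    separate u v u≢v with u ≟ S zero | covers u | covers v
    ... | no u≢S₀  | zero  , u≡S₀ | _          = contradiction u≡S₀ u≢S₀
    ... | no _     | suc i , refl | _          = i , λ a b da db → self-separates G u≢v da db
    ... | yes refl | _            | zero , refl = contradiction refl u≢v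
    ... | yes refl | _            | suc i , refl = i , λ a b da db a≡b →
                                    self-separates G (u≢v ∘ sym) db da (sym a≡b)

  ¬¬-outside-minimal-resolving : ∀ {k} (S : Fin k → V G) → IsResolvingSet G S →
    (∀ {m} (T : Fin m → V G) → IsResolvingSet G T → k ≤ m) →
    V G → DoubleNegation (∃ λ v → ∀ i → ¬ v ≡ S i)
  ¬¬-outside-minimal-resolving {zero}  S _        _       v ∄outside = ∄outside (v , λ ())
  ¬¬-outside-minimal-resolving {suc k} S resolves minimal _ ∄outside =
    1+n≰n (minimal (S ∘ suc) (resolving-tail S resolves covers))
    where
    covers : ∀ v → ∃ λ i → v ≡ S i
    covers v with Fin.any? (λ i → v ≟ S i)
    ... | yes v∈S = v∈S
    ... | no  v∉S = contradiction (v , λ i v≡Sᵢ → v∉S (i , v≡Sᵢ)) ∄outside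

_++ʷ_ : ∀ {G u w v} → Walk G u w → Walk G w v → Walk G u v
[]      ++ʷ q = q
(e ∷ p) ++ʷ q = e ∷ (p ++ʷ q)

length-++ʷ : ∀ {G u w v} (p : Walk G u w) (q : Walk G w v) → length (p ++ʷ q) ≡ length p + length q
length-++ʷ []      q = refl
length-++ʷ (e ∷ p) q = cong suc (length-++ʷ p q)

module _ (G₁ G₂ : Graph) where

  horizontal : ∀ {a c} (b : V G₂) → Walk G₁ a c → Walk (G₁ □ G₂) (a , b) (c , b)
  horizontal b []      = []
  horizontal b (e ∷ w) = inj₂ (refl , e) ∷ horizontal b w

  vertical : ∀ {b d} (a : V G₁) → Walk G₂ b d → Walk (G₁ □ G₂) (a , b) (a , d)
  vertical a []      = []
  vertical a (e ∷ w) = inj₁ (refl , e) ∷ vertical a w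

  length-horizontal : ∀ {a c} b (w : Walk G₁ a c) → length (horizontal b w) ≡ length w
  length-horizontal b []      = refl
  length-horizontal b (e ∷ w) = cong suc (length-horizontal b w)

  length-vertical : ∀ {b d} a (w : Walk G₂ b d) → length (vertical a w) ≡ length w
  length-vertical a []      = refl
  length-vertical a (e ∷ w) = cong suc (length-vertical a w)

  project₁ : ∀ {u v} → Walk (G₁ □ G₂) u v → Walk G₁ (proj₁ u) (proj₁ v)
  project₁ []                    = []
  project₁ (inj₁ (refl , _) ∷ w) = project₁ w
  project₁ (inj₂ (_ , e)    ∷ w) = e ∷ project₁ w

  project₂ : ∀ {u v} → Walk (G₁ □ G₂) u v → Walk G₂ (proj₂ u) (proj₂ v)
  project₂ []                    = []
  project₂ (inj₁ (_ , e)    ∷ w) = e ∷ project₂ w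
  project₂ (inj₂ (refl , _) ∷ w) = project₂ w

  length-project : ∀ {u v} (w : Walk (G₁ □ G₂) u v) →
                   length (project₁ w) + length (project₂ w) ≡ length w
  length-project []                    = refl
  length-project (inj₁ (refl , _) ∷ w) = trans (+-suc _ _) (cong suc (length-project w))
  length-project (inj₂ (refl , _) ∷ w) = cong suc (length-project w)

  dist₂-≤-walk : ∀ {a b c d β} → IsDist G₂ b d β → (w : Walk (G₁ □ G₂) (a , b) (c , d)) → β ≤ length w
  dist₂-≤-walk (_ , least) w =
    ≤-trans (least (project₂ w)) (≤-trans (m≤n+m _ _) (≤-reflexive (length-project w)))

  distToSet-row : ∀ {Q : V (G₁ □ G₂) → Set} {t a b α x} →
    (∀ {z} → Q z → proj₂ z ≡ t) → (∀ c → Q (c , t)) →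
    IsDist G₂ b t α → IsDistToSet (G₁ □ G₂) (a , b) Q x → x ≡ α
  distToSet-row {a = a} {b} inRow rowInQ dα@((wα , refl) , _) dx@((_ , qz , (w , refl) , _) , _) =
    ≤-antisym (≤-trans (distToSet-≤-walk (G₁ □ G₂) dx (rowInQ a) (vertical a wα))
                       (≤-reflexive (length-vertical a wα)))
              (dist₂-≤-walk (subst (λ y → IsDist G₂ b y (length wα)) (sym (inRow qz)) dα) w)

  distToSet-column-≤ : ∀ {Q : V (G₁ □ G₂) → Set} {s a a′ b α β x y} →
    (∀ {z} → Q z → proj₁ z ≡ s) → IsDist G₁ a s α → IsDist G₁ a′ s β →
    IsDistToSet (G₁ □ G₂) (a , b) Q x → IsDistToSet (G₁ □ G₂) (a′ , b) Q y → x + β ≤ α + y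
  distToSet-column-≤ {b = b} {β = β} {x} inColumn ((wα , refl) , _) (_ , β-least) dx
                     (((z₁ , _) , qz , (w , refl) , _) , _) with inColumn qz
  ... | refl = begin
    x + β                                            ≤⟨ +-monoˡ-≤ β x≤α+m ⟩
    length wα + m + β                                ≤⟨ +-monoʳ-≤ (length wα + m) (β-least (project₁ w)) ⟩
    length wα + m + length (project₁ w)              ≡⟨ +-assoc (length wα) m _ ⟩
    length wα + (m + length (project₁ w))            ≡⟨ cong (length wα +_) (+-comm m _) ⟩
    length wα + (length (project₁ w) + m)            ≡⟨ cong (length wα +_) (length-project w) ⟩
    length wα + length w                             ∎
    where
    open ≤-Reasoning
    m = length (project₂ w)
    detour = horizontal b wα ++ʷ vertical z₁ (project₂ w)
    x≤α+m : x ≤ length wα + m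
    x≤α+m = begin
      x                  ≤⟨ distToSet-≤-walk (G₁ □ G₂) dx qz detour ⟩
      length detour      ≡⟨ length-++ʷ (horizontal b wα) _ ⟩
      _                  ≡⟨ cong₂ _+_ (length-horizontal b wα) (length-vertical z₁ _) ⟩
      length wα + m      ∎

  distToSet-column-injective : ∀ {Q : V (G₁ □ G₂) → Set} {s a a′ b α β x y} →
    (∀ {z} → Q z → proj₁ z ≡ s) → IsDist G₁ a s α → IsDist G₁ a′ s β →
    IsDistToSet (G₁ □ G₂) (a , b) Q x → IsDistToSet (G₁ □ G₂) (a′ , b) Q y → x ≡ y → α ≡ β
  distToSet-column-injective {x = x} inColumn dα dβ dx dy refl =
    ≤-antisym (cancel (distToSet-column-≤ inColumn dβ dα dy dx))
              (cancel (distToSet-column-≤ inColumn dα dβ dx dy))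
    where
    cancel : ∀ {m n} → x + m ≤ n + x → m ≤ n
    cancel {m} {n} le = +-cancelˡ-≤ x m n (≤-trans le (≤-reflexive (+-comm n x)))

module ProductPartition
  (G₁ G₂ : Graph) (conn₁ : Connected G₁) (conn₂ : Connected G₂)
  (_≟₁_ : DecidableEquality (V G₁)) (_≟₂_ : DecidableEquality (V G₂))
  {k₁ k₂ : ℕ} (S₁ : Fin k₁ → V G₁) (S₂ : Fin k₂ → V G₂)
  (res₁ : IsResolvingSet G₁ S₁) (res₂ : IsResolvingSet G₂ S₂)
  (r₀ : V G₁) (r₀∉S₁ : ∀ i → ¬ r₀ ≡ S₁ i) (q₀ : V G₂) (q₀∉S₂ : ∀ j → ¬ q₀ ≡ S₂ j)
  where

  Label : Set
  Label = (Fin k₁ ⊎ Fin k₂) ⊎ Fin 1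

  column : Fin k₁ → Label
  column = inj₁ ∘ inj₁

  row : Fin k₂ → Label
  row = inj₁ ∘ inj₂

  rest : Label
  rest = inj₂ zero

  labels : Fin (k₁ + k₂ + 1) ↔ Label
  labels = ↔-trans Fin.+↔⊎ (Fin.+↔⊎ ⊎-↔ ↔-refl)

  open Inverse labels using (to; from; strictlyInverseˡ; strictlyInverseʳ)

  from-injective : ∀ {ℓ ℓ′} → from ℓ ≡ from ℓ′ → ℓ ≡ ℓ′
  from-injective {ℓ} {ℓ′} eq = trans (sym (strictlyInverseˡ ℓ)) (trans (cong to eq) (strictlyInverseˡ ℓ′))

  classify : ∀ {a b} → Dec (∃ λ j → b ≡ S₂ j) → Dec (∃ λ i → a ≡ S₁ i) → Label
  classify (yes (j , _)) _             = row j
  classify (no _)        (yes (i , _)) = column i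
  classify (no _)        (no _)        = rest

  index₁ : ∀ a → Dec (∃ λ i → a ≡ S₁ i)
  index₁ a = Fin.any? (λ i → a ≟₁ S₁ i)

  index₂ : ∀ b → Dec (∃ λ j → b ≡ S₂ j)
  index₂ b = Fin.any? (λ j → b ≟₂ S₂ j)

  labelOf : V (G₁ □ G₂) → Label
  labelOf (a , b) = classify (index₂ b) (index₁ a)

  partition : V (G₁ □ G₂) → Fin (k₁ + k₂ + 1)
  partition = from ∘ labelOf

  classify-row : ∀ {a b j} d₂ d₁ → classify {a} {b} d₂ d₁ ≡ row j → b ≡ S₂ j
  classify-row (yes (_ , b≡Sⱼ)) _ refl = b≡Sⱼ
  classify-row (no _) (yes _) ()
  classify-row (no _) (no _)  ()

  classify-column : ∀ {a b i} d₂ d₁ → classify {a} {b} d₂ d₁ ≡ column i → a ≡ S₁ i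
  classify-column (yes _) _                  ()
  classify-column (no _)  (yes (_ , a≡Sᵢ)) refl = a≡Sᵢ
  classify-column (no _)  (no _)             ()

  in-row : ∀ {j z} → partition z ≡ from (row j) → proj₂ z ≡ S₂ j
  in-row {z = a , b} eq = classify-row (index₂ b) (index₁ a) (from-injective eq)

  in-column : ∀ {i z} → partition z ≡ from (column i) → proj₁ z ≡ S₁ i
  in-column {z = a , b} eq = classify-column (index₂ b) (index₁ a) (from-injective eq)

  labelOf-row : ∀ j a → labelOf (a , S₂ j) ≡ row j
  labelOf-row j a with index₂ (S₂ j)
  ... | yes (_ , Sⱼ≡Sⱼ′) = cong row (sym (proj₁ res₂ Sⱼ≡Sⱼ′))
  ... | no  Sⱼ∉S₂        = contradiction (j , refl) Sⱼ∉S₂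

  labelOf-column : ∀ i → labelOf (S₁ i , q₀) ≡ column i
  labelOf-column i with index₂ q₀
  ... | yes (j , q₀≡Sⱼ) = contradiction q₀≡Sⱼ (q₀∉S₂ j)
  ... | no _ with index₁ (S₁ i)
  ...   | yes (_ , Sᵢ≡Sᵢ′) = cong column (sym (proj₁ res₁ Sᵢ≡Sᵢ′))
  ...   | no  Sᵢ∉S₁        = contradiction (i , refl) Sᵢ∉S₁

  labelOf-rest : labelOf (r₀ , q₀) ≡ rest
  labelOf-rest with index₂ q₀
  ... | yes (j , q₀≡Sⱼ) = contradiction q₀≡Sⱼ (q₀∉S₂ j)
  ... | no _ with index₁ r₀
  ...   | yes (i , r₀≡Sᵢ) = contradiction r₀≡Sᵢ (r₀∉S₁ i)
  ...   | no _            = refl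

  labelOf-surjective : ∀ ℓ → ∃ λ z → labelOf z ≡ ℓ
  labelOf-surjective (inj₁ (inj₁ i)) = (S₁ i , q₀) , labelOf-column i
  labelOf-surjective (inj₁ (inj₂ j)) = (r₀ , S₂ j) , labelOf-row j r₀
  labelOf-surjective (inj₂ zero)     = (r₀ , q₀) , labelOf-rest

  partition-surjective : Surjective _≡_ _≡_ partition
  partition-surjective y with labelOf-surjective (to y)
  ... | z , labelOf-z = z , λ { refl → trans (cong from labelOf-z) (strictlyInverseʳ y) }

  Separates : V (G₁ □ G₂) → V (G₁ □ G₂) → Fin (k₁ + k₂ + 1) → Set
  Separates u v c = ∀ x y → IsDistToSet (G₁ □ G₂) u (λ z → partition z ≡ c) x →
                            IsDistToSet (G₁ □ G₂) v (λ z → partition z ≡ c) y → ¬ x ≡ y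

  row-separates : ∀ {a a′ b b′} j →
    (∀ α β → IsDist G₂ b (S₂ j) α → IsDist G₂ b′ (S₂ j) β → ¬ α ≡ β) →
    Separates (a , b) (a′ , b′) (from (row j))
  row-separates {b = b} {b′} j sep x y dx dy x≡y =
    ¬¬-dist G₂ (conn₂ b (S₂ j)) λ (α , dα) →
    ¬¬-dist G₂ (conn₂ b′ (S₂ j)) λ (β , dβ) →
    sep α β dα dβ (trans (sym (d-row dα dx)) (trans x≡y (d-row dβ dy)))
    where
    d-row : ∀ {c d γ z} → IsDist G₂ d (S₂ j) γ →
            IsDistToSet (G₁ □ G₂) (c , d) (λ z → partition z ≡ from (row j)) z → z ≡ γ
    d-row = distToSet-row G₁ G₂ in-row (λ a → cong from (labelOf-row j a))

  column-separates : ∀ {a a′ b} i →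
    (∀ α β → IsDist G₁ a (S₁ i) α → IsDist G₁ a′ (S₁ i) β → ¬ α ≡ β) →
    Separates (a , b) (a′ , b) (from (column i))
  column-separates {a} {a′} i sep x y dx dy x≡y =
    ¬¬-dist G₁ (conn₁ a (S₁ i)) λ (α , dα) →
    ¬¬-dist G₁ (conn₁ a′ (S₁ i)) λ (β , dβ) →
    sep α β dα dβ (distToSet-column-injective G₁ G₂ in-column dα dβ dx dy x≡y)

  isResolvingPartition : IsResolvingPartition (G₁ □ G₂) partition
  isResolvingPartition = partition-surjective , resolves
    where
    resolves : ∀ u v → ¬ u ≡ v → ∃ (Separates u v)
    resolves (a , b) (a′ , b′) u≢v with b ≟₂ b′
    ... | no b≢b′ = let j , sep = proj₂ res₂ b b′ b≢b′ in from (row j) , row-separates j sep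
    ... | yes refl = let i , sep = proj₂ res₁ a a′ (u≢v ∘ cong (_, b)) in
                     from (column i) , column-separates i sep

partitionDim-empty : ∀ {G p} → ¬ V G → IsPartitionDim G p → p ≡ 0
partitionDim-empty ∄v (_ , minimal) = n≤0⇒n≡0 (minimal (⊥-elim ∘ ∄v) ((λ ()) , ⊥-elim ∘ ∄v))

corollary2 : (G₁ G₂ : Graph) → Connected G₁ → Connected G₂ →
    ∀ (k₁ k₂ p : ℕ) → IsMetricDim G₁ k₁ → IsMetricDim G₂ k₂ →
    IsPartitionDim (G₁ □ G₂) p → p ≤ k₁ + k₂ + 1
corollary2 G₁ G₂ conn₁ conn₂ k₁ k₂ p ((S₁ , res₁) , min₁) ((S₂ , res₂) , min₂) pd
  with vertex-or-empty G₁ | vertex-or-empty G₂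
... | inj₂ ∄₁ | _       = subst (_≤ k₁ + k₂ + 1) (sym (partitionDim-empty (∄₁ ∘ proj₁) pd)) z≤n
... | inj₁ _  | inj₂ ∄₂ = subst (_≤ k₁ + k₂ + 1) (sym (partitionDim-empty (∄₂ ∘ proj₂) pd)) z≤n
... | inj₁ v₁ | inj₁ v₂ = ≤-stable do
  _≟₁_ ← ¬¬-decEq G₁
  _≟₂_ ← ¬¬-decEq G₂
  r₀ , r₀∉S₁ ← ¬¬-outside-minimal-resolving G₁ _≟₁_ S₁ res₁ min₁ v₁
  q₀ , q₀∉S₂ ← ¬¬-outside-minimal-resolving G₂ _≟₂_ S₂ res₂ min₂ v₂
  pure (proj₂ pd _ (ProductPartition.isResolvingPartition G₁ G₂ conn₁ conn₂ _≟₁_ _≟₂_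
                      S₁ S₂ res₁ res₂ r₀ r₀∉S₁ q₀ q₀∉S₂))
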